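{- Let $k\ge 3$ and $n$ be integers with $n>3k-3$, and let $H$ be a blue cycle of length $n+1$. Then $\tilde{r}_H(C_k,C_n)\le k+2$.
   Context: Online Ramsey game: Builder and Painter play on the infinite complete graph $K_{\mathbb N}$. For a colored graph $H$ (each edge red or blue), the game $\tilde R_H(G_1,G_2)$ starts with a copy of $H$ already drawn and colored on the board. In each round Builder selects a previously unselected edge and Painter colors it red or blue. The game ends as soon as the graph of all colored edges contains a red copy of $G_1$ or a blue copy of $G_2$. $\tilde{r}_H(G_1,G_2)$ is the minimum number of rounds within which Builder can guarantee the end of the game, both playing optimally. $C_k$ is the cycle on $k$ vertices. -}

module Defs where

open import Data.Nat using (ℕ; zero; suc; _+_; _*_; _∸_; _<_; _≤_)
open import Data.List using (List; _∷_; []; map; upTo; _++_)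
open import Data.List.Membership.Propositional using (_∈_)
open import Data.Product using (Σ; ∃; _×_; _,_)
open import Data.Sum using (_⊎_)
open import Relation.Nullary using (¬_)
open import Relation.Binary.PropositionalEquality using (_≡_; _≢_)

data Colour : Set where
  red blue : Colour

-- A board position: the list of coloured edges drawn so far, each as
-- (endpoint , endpoint , colour) on vertex set ℕ (the infinite complete graph K_ℕ).
-- Edges are unordered: (u , v , c) and (v , u , c) denote the same edge.
Board : Set
Board = List (ℕ × ℕ × Colour)

ColouredEdge : Board → Colour → ℕ → ℕ → Set
ColouredEdge s c u v = ((u , v , c) ∈ s) ⊎ ((v , u , c) ∈ s)

Selected : Board → ℕ → ℕ → Set
Selected s u v = ∃ λ c → ColouredEdge s c u v

HasCycle : Colour → ℕ → Board → Set
HasCycle c len s =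
  Σ (ℕ → ℕ) λ f →
    (∀ i j → i < len → j < len → f i ≡ f j → i ≡ j)
    × (∀ i → suc i < len → ColouredEdge s c (f i) (f (suc i)))
    × ColouredEdge s c (f (len ∸ 1)) (f 0)

Ended : ℕ → ℕ → Board → Set
Ended k n s = HasCycle red k s ⊎ HasCycle blue n s

-- BuilderWins k n m s : from position s, Builder can guarantee that the game
-- R̃(C_k, C_n) ends within at most m further rounds, against every Painter.
data BuilderWins (k n : ℕ) : ℕ → Board → Set where
  ended : ∀ {m s} → Ended k n s → BuilderWins k n m s
  move  : ∀ {m s} (u v : ℕ) → u ≢ v → ¬ Selected s u v →
          (∀ c → BuilderWins k n m ((u , v , c) ∷ s)) →
          BuilderWins k n (suc m) s

-- A blue cycle of length len+1 on vertices 0, 1, …, len.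
blueCycle : ℕ → Board
blueCycle len = map (λ i → (i , suc i , blue)) (upTo len) ++ ((len , 0 , blue) ∷ [])

{-# OPTIONS --safe #-}
-- Write K = 2k − 1 and call a chord {u, u + 2} of the blue cycle 0, 1, …, n a rung: a blue
-- rung gives a blue C_n that skips u + 1, so Painter must colour every rung red.  Builder
-- first draws {0, K}.  If it is blue, he draws the k − 1 rungs from 2 to 2k and then {2, 2k}:
-- red closes a red C_k on 2, 4, …, 2k, while blue yields a blue C_n through both chords that
-- misses only the vertex 1.  If {0, K} is red, he draws {2α, K + 2β} with α + β = k − 2 and
-- α, β balanced.  When it is blue, the same ending works with rungs from k to 3k − 2; when it
-- is red, the rungs from 0 to 2α and from K to K + 2β close the red C_k
-- 0, 2, …, 2α, K + 2β, …, K.  The ladders fit on the cycle because n > 3k − 3, and every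
-- branch uses at most k + 2 rounds.

module Submission where

open import Defs
open import Data.Nat using (ℕ; zero; suc; _+_; _*_; _∸_; _<_; _≤_; _≮_; z≤n; s≤s; z<s; ⌊_/2⌋; ⌈_/2⌉)
open import Data.Nat.Properties
open import Data.Nat.Tactic.RingSolver using (solve-∀)
open import Data.List using (_∷_; []; map; upTo; _++_)
open import Data.List.Membership.Propositional using (_∈_)
open import Data.List.Membership.Propositional.Properties using (∈-++⁺ˡ; ∈-++⁺ʳ; ∈-map⁺; ∈-upTo⁺)
open import Data.List.Relation.Binary.Subset.Propositional using (_⊆_)
open import Data.List.Relation.Binary.Subset.Propositional.Properties using (xs⊆ys++xs; ∷⁺ʳ)
open import Data.List.Relation.Unary.Any using (here; there)
open import Data.List.Relation.Unary.All as All using (All; []; _∷_)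
open import Data.List.Relation.Unary.All.Properties using (++⁺; map⁺)
open import Data.Product using (_×_; _,_; proj₁; proj₂)
open import Data.Sum using (_⊎_; inj₁; inj₂; [_,_])
open import Data.Empty using (⊥-elim)
open import Relation.Nullary using (¬_; yes; no)
open import Relation.Binary.PropositionalEquality hiding ([_])

colouredEdge-mono : ∀ {s t c u v} → s ⊆ t → ColouredEdge s c u v → ColouredEdge t c u v
colouredEdge-mono s⊆t (inj₁ e) = inj₁ (s⊆t e)
colouredEdge-mono s⊆t (inj₂ e) = inj₂ (s⊆t e)

colouredEdge-sym : ∀ {s c u v} → ColouredEdge s c u v → ColouredEdge s c v u
colouredEdge-sym (inj₁ e) = inj₂ e
colouredEdge-sym (inj₂ e) = inj₁ e

colouredEdge-resp-≡ : ∀ {s c x y x′ y′} → x ≡ x′ → y ≡ y′ → ColouredEdge s c x′ y′ → ColouredEdge s c x y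
colouredEdge-resp-≡ refl refl e = e

hasCycle-mono : ∀ {s t c len} → s ⊆ t → HasCycle c len s → HasCycle c len t
hasCycle-mono s⊆t (f , injective , path , closing) =
  f , injective , (λ i i<len → colouredEdge-mono s⊆t (path i i<len)) , colouredEdge-mono s⊆t closing

builderWins-mono : ∀ {k n m m′ s} → m ≤ m′ → BuilderWins k n m s → BuilderWins k n m′ s
builderWins-mono _         (ended e)            = ended e
builderWins-mono (s≤s m≤m′) (move u v u≢v fresh next) = move u v u≢v fresh (λ c → builderWins-mono m≤m′ (next c))

Avoids : ℕ → ℕ → ℕ × ℕ × Colour → Set
Avoids u v (x , y , _) = ¬ (x ≡ u × y ≡ v) × ¬ (x ≡ v × y ≡ u)

unselected : ∀ {s u v} → All (Avoids u v) s → ¬ Selected s u v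
unselected avoids (_ , inj₁ e) = proj₁ (All.lookup avoids e) (refl , refl)
unselected avoids (_ , inj₂ e) = proj₂ (All.lookup avoids e) (refl , refl)

avoids-missingˡ : ∀ {u v x y col} → x ≢ u → y ≢ u → Avoids u v (x , y , col)
avoids-missingˡ x≢u y≢u = (λ (x≡u , _) → x≢u x≡u) , (λ (_ , y≡u) → y≢u y≡u)

avoids-missingʳ : ∀ {u v x y col} → x ≢ v → y ≢ v → Avoids u v (x , y , col)
avoids-missingʳ x≢v y≢v = (λ (_ , y≡v) → y≢v y≡v) , (λ (x≡v , _) → x≢v x≡v)

avoids-outside : ∀ {u v x y col} → x ≢ u → x ≢ v → Avoids u v (x , y , col)
avoids-outside x≢u x≢v = (λ (x≡u , _) → x≢u x≡u) , (λ (x≡v , _) → x≢v x≡v)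

2+n≮n : ∀ n → 2 + n ≮ n
2+n≮n = m+n≮n 2

chord-avoids : ∀ {u v x col} → u < v → v ≢ 2 + u → Avoids u v (x , 2 + x , col)
chord-avoids u<v v≢2+u =
  (λ { (refl , refl) → v≢2+u refl }) , (λ { (refl , refl) → 2+n≮n _ u<v })

avoids-chord : ∀ {u x y col} → x < y → y ≢ 2 + x → Avoids u (2 + u) (x , y , col)
avoids-chord x<y y≢2+x =
  (λ { (refl , refl) → y≢2+x refl }) , (λ { (refl , refl) → 2+n≮n _ x<y })

∈-blueCycle-path : ∀ n {t} → t < n → (t , suc t , blue) ∈ blueCycle n
∈-blueCycle-path n t<n = ∈-++⁺ˡ (∈-map⁺ (λ i → (i , suc i , blue)) (∈-upTo⁺ t<n))

∈-blueCycle-closing : ∀ n → (n , 0 , blue) ∈ blueCycle n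
∈-blueCycle-closing n = ∈-++⁺ʳ (map (λ i → (i , suc i , blue)) (upTo n)) (here refl)

blueCycle-avoids : ∀ n {u v} → suc u < v → 0 < u ⊎ v < n → All (Avoids u v) (blueCycle n)
blueCycle-avoids n {u} {v} 1+u<v 0<u⊎v<n =
  ++⁺ (map⁺ (All.universal path-avoids (upTo n))) (closing-avoids ∷ [])
  where
  path-avoids : ∀ t → Avoids u v (t , suc t , blue)
  path-avoids t = (λ { (refl , refl) → n≮n _ 1+u<v }) , (λ { (refl , refl) → 2+n≮n _ 1+u<v })
  closing-avoids : Avoids u v (n , 0 , blue)
  closing-avoids = (λ { (refl , refl) → n≮0 1+u<v }) , λ { (refl , refl) → [ n≮n 0 , n≮n n ] 0<u⊎v<n }

blueCycle-shortcut : ∀ {n} u → 2 + u ≤ n → HasCycle blue n ((u , 2 + u , blue) ∷ blueCycle n)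
blueCycle-shortcut {suc n} u (s≤s 1+u≤n) = skip , injective , path , closing
  where
  board : Board
  board = (u , 2 + u , blue) ∷ blueCycle (suc n)

  skip : ℕ → ℕ
  skip j with j ≤? u
  ... | yes _ = j
  ... | no  _ = suc j

  skip-≤ : ∀ {j} → j ≤ u → skip j ≡ j
  skip-≤ {j} j≤u with j ≤? u
  ... | yes _   = refl
  ... | no  j≰u = ⊥-elim (j≰u j≤u)

  skip-> : ∀ {j} → u < j → skip j ≡ suc j
  skip-> {j} u<j with j ≤? u
  ... | yes j≤u = ⊥-elim (<⇒≱ u<j j≤u)
  ... | no  _   = refl

  injective : ∀ i j → i < suc n → j < suc n → skip i ≡ skip j → i ≡ j
  injective i j _ _ eq with ≤-<-connex i u | ≤-<-connex j u
  ... | inj₁ i≤u | inj₁ j≤u = trans (sym (skip-≤ i≤u)) (trans eq (skip-≤ j≤u))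
  ... | inj₂ u<i | inj₂ u<j = suc-injective (trans (sym (skip-> u<i)) (trans eq (skip-> u<j)))
  ... | inj₁ i≤u | inj₂ u<j = ⊥-elim (<⇒≱ u<j (≤-trans (n≤1+n j) (subst (_≤ u) i≡1+j i≤u)))
    where i≡1+j : i ≡ suc j
          i≡1+j = trans (sym (skip-≤ i≤u)) (trans eq (skip-> u<j))
  ... | inj₂ u<i | inj₁ j≤u = ⊥-elim (<⇒≱ u<i (≤-trans (n≤1+n i) (subst (_≤ u) j≡1+i j≤u)))
    where j≡1+i : j ≡ suc i
          j≡1+i = trans (sym (skip-≤ j≤u)) (trans (sym eq) (skip-> u<i))

  path : ∀ j → suc j < suc n → ColouredEdge board blue (skip j) (skip (suc j))
  path j 1+j<1+n with ≤-<-connex (suc j) u | ≤-<-connex j u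
  ... | inj₁ 1+j≤u | _ =
    colouredEdge-resp-≡ (skip-≤ (≤-trans (n≤1+n j) 1+j≤u)) (skip-≤ 1+j≤u)
      (inj₁ (there (∈-blueCycle-path (suc n) (<-trans (n<1+n j) 1+j<1+n))))
  ... | inj₂ u<1+j | inj₂ u<j =
    colouredEdge-resp-≡ (skip-> u<j) (skip-> u<1+j)
      (inj₁ (there (∈-blueCycle-path (suc n) 1+j<1+n)))
  ... | inj₂ u<1+j | inj₁ j≤u with ≤∧≮⇒≡ j≤u (<⇒≱ u<1+j)
  ...   | refl = colouredEdge-resp-≡ (skip-≤ j≤u) (skip-> u<1+j) (inj₁ (here refl))

  closing : ColouredEdge board blue (skip n) (skip 0)
  closing = colouredEdge-resp-≡ (skip-> 1+u≤n) (skip-≤ z≤n)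
              (inj₁ (there (∈-blueCycle-closing (suc n))))

-- The tour runs 0 … a, jumps to c + w, runs down to c, jumps to d and runs up to the end.  It
-- skips the vertices strictly between a and c and those strictly between c + w and d: one
-- vertex in total, since d = a + w + 3.
module TwoChordTour (a c w : ℕ) where

  d : ℕ
  d = 3 + (a + w)

  tour : ℕ → ℕ
  tour j with j ≤? a
  ... | yes _ = j
  ... | no  _ with j ∸ suc a ≤? w
  ...   | yes _ = c + (w ∸ (j ∸ suc a))
  ...   | no  _ = d + (j ∸ suc a ∸ suc w)

  tour-first : ∀ {i} → i ≤ a → tour i ≡ i
  tour-first {i} i≤a with i ≤? a
  ... | yes _   = refl
  ... | no  i≰a = ⊥-elim (i≰a i≤a)

  tour-middle : ∀ {m} → m ≤ w → tour (suc a + m) ≡ c + (w ∸ m)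
  tour-middle {m} m≤w with suc a + m ≤? a
  ... | yes 1+a+m≤a = ⊥-elim (m+n≮m (suc a) m (s≤s 1+a+m≤a))
  ... | no  _ with suc a + m ∸ suc a ≤? w
  ...   | yes _ = cong (λ x → c + (w ∸ x)) (m+n∸m≡n (suc a) m)
  ...   | no ≰w = ⊥-elim (≰w (subst (_≤ w) (sym (m+n∸m≡n (suc a) m)) m≤w))

  dropFirst : ∀ p → suc a + suc w + p ∸ suc a ≡ suc w + p
  dropFirst p = trans (cong (_∸ suc a) (+-assoc (suc a) (suc w) p)) (m+n∸m≡n (suc a) (suc w + p))

  tour-last : ∀ p → tour (suc a + suc w + p) ≡ d + p
  tour-last p with suc a + suc w + p ≤? a
  ... | yes ≤a = ⊥-elim (m+n≮m (suc a) (suc w + p) (s≤s (subst (_≤ a) (+-assoc (suc a) (suc w) p) ≤a)))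
  ... | no  _ with suc a + suc w + p ∸ suc a ≤? w
  ...   | yes ≤w = ⊥-elim (m+n≮m (suc w) p (s≤s (subst (_≤ w) (dropFirst p) ≤w)))
  ...   | no  _  = trans (cong (λ x → d + (x ∸ suc w)) (dropFirst p)) (cong (d +_) (m+n∸m≡n (suc w) p))


  data Segment (j : ℕ) : Set where
    first  : j ≤ a → Segment j
    middle : ∀ m → m ≤ w → j ≡ suc a + m → Segment j
    last   : ∀ p → j ≡ suc a + suc w + p → Segment j

  segment : ∀ j → Segment j
  segment j with ≤-<-connex j a
  ... | inj₁ j≤a = first j≤a
  ... | inj₂ a<j with ≤-<-connex (j ∸ suc a) w
  ...   | inj₁ m≤w = middle (j ∸ suc a) m≤w (sym (m+[n∸m]≡n a<j))
  ...   | inj₂ w<m = last (j ∸ suc a ∸ suc w)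
            (sym (trans (+-assoc (suc a) (suc w) _) (trans (cong (suc a +_) (m+[n∸m]≡n w<m)) (m+[n∸m]≡n a<j))))

  untour : ℕ → ℕ
  untour v with v ≤? a
  ... | yes _ = v
  ... | no  _ with d ≤? v
  ...   | yes _ = suc a + suc w + (v ∸ d)
  ...   | no  _ = suc a + (c + w ∸ v)

  untour-first : ∀ {v} → v ≤ a → untour v ≡ v
  untour-first {v} v≤a with v ≤? a
  ... | yes _   = refl
  ... | no  v≰a = ⊥-elim (v≰a v≤a)

  untour-middle : ∀ {v} → a < v → v < d → untour v ≡ suc a + (c + w ∸ v)
  untour-middle {v} a<v v<d with v ≤? a
  ... | yes v≤a = ⊥-elim (<⇒≱ a<v v≤a)
  ... | no  _ with d ≤? v
  ...   | yes d≤v = ⊥-elim (<⇒≱ v<d d≤v)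
  ...   | no  _   = refl

  untour-last : ∀ {v} → a < v → d ≤ v → untour v ≡ suc a + suc w + (v ∸ d)
  untour-last {v} a<v d≤v with v ≤? a
  ... | yes v≤a = ⊥-elim (<⇒≱ a<v v≤a)
  ... | no  _ with d ≤? v
  ...   | yes _   = refl
  ...   | no  d≰v = ⊥-elim (d≰v d≤v)

blueCycle-twoChords : ∀ {n a b c d} → a < c → c ≤ b → b < d → d ≤ n → c + d ≡ 3 + (a + b) →
  HasCycle blue n ((c , d , blue) ∷ (a , b , blue) ∷ blueCycle n)
blueCycle-twoChords {a = a} {c = c} {d = d} a<c c≤b b<d d≤n c+d≡3+a+b
  with m≤n⇒∃[o]m+o≡n c≤b | m≤n⇒∃[o]m+o≡n d≤n
... | w , refl | r , refl with +-cancelˡ-≡ c d (3 + (a + w)) (trans c+d≡3+a+b (shift a c w))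
  where
  shift : ∀ a c w → 3 + (a + (c + w)) ≡ c + (3 + (a + w))
  shift = solve-∀
... | refl = tour , injective , path , closing
  where
  open TwoChordTour a c w hiding (d)

  board : Board
  board = (c , d , blue) ∷ (a , c + w , blue) ∷ blueCycle (d + r)

  untour∘tour : ∀ j → untour (tour j) ≡ j
  untour∘tour j with segment j
  ... | first j≤a rewrite tour-first j≤a = untour-first j≤a
  ... | middle m m≤w refl rewrite tour-middle m≤w =
    trans (untour-middle (<-≤-trans a<c (m≤m+n c _)) (≤-<-trans (+-monoʳ-≤ c (m∸n≤m w m)) b<d))
          (cong (suc a +_) (trans ([m+n]∸[m+o]≡n∸o c w (w ∸ m)) (m∸[m∸n]≡n m≤w)))
  ... | last p refl rewrite tour-last p =
    trans (untour-last (<-≤-trans (<-trans a<c (≤-<-trans c≤b b<d)) (m≤m+n d p)) (m≤m+n d p))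
          (cong (suc a + suc w +_) (m+n∸m≡n d p))

  injective : ∀ i j → i < d + r → j < d + r → tour i ≡ tour j → i ≡ j
  injective i j _ _ eq = trans (sym (untour∘tour i)) (trans (cong untour eq) (untour∘tour j))

  path : ∀ j → suc j < d + r → ColouredEdge board blue (tour j) (tour (suc j))
  path j 1+j<n with segment j
  ... | first j≤a with ≤-<-connex (suc j) a
  ...   | inj₁ 1+j≤a = colouredEdge-resp-≡ (tour-first j≤a) (tour-first 1+j≤a)
                         (inj₁ (there (there (∈-blueCycle-path (d + r) (<-trans (n<1+n j) 1+j<n)))))
  ...   | inj₂ a<1+j with ≤∧≮⇒≡ j≤a (<⇒≱ a<1+j)
  ...     | refl = colouredEdge-resp-≡ (tour-first j≤a) (trans (cong tour (sym (+-identityʳ (suc a)))) (tour-middle z≤n))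
                     (inj₁ (there (here refl)))
  path j 1+j<n | middle m m≤w refl with ≤-<-connex (suc m) w
  ...   | inj₁ m<w = colouredEdge-resp-≡ (trans (tour-middle m≤w) (trans (cong (c +_) (+-∸-assoc 1 m<w)) (+-suc c (w ∸ suc m))))
                          (trans (cong tour (sym (+-suc (suc a) m))) (tour-middle m<w))
                          (inj₂ (there (there (∈-blueCycle-path (d + r) inside))))
    where
    inside : c + (w ∸ suc m) < d + r
    inside = ≤-trans (s≤s (+-monoʳ-≤ c (m∸n≤m w (suc m)))) (≤-trans b<d (m≤m+n d r))
  ...   | inj₂ w<1+m with ≤∧≮⇒≡ m≤w (<⇒≱ w<1+m)
  ...     | refl = colouredEdge-resp-≡ (trans (tour-middle m≤w) (trans (cong (c +_) (n∸n≡0 m)) (+-identityʳ c)))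
                        (trans (cong tour (trans (sym (+-suc (suc a) m)) (sym (+-identityʳ (suc a + suc m)))))
                               (trans (tour-last 0) (+-identityʳ d)))
                        (inj₁ (here refl))
  path j 1+j<n | last p refl =
    colouredEdge-resp-≡ (tour-last p) (trans (cong tour (sym (+-suc (suc a + suc w) p))) (trans (tour-last (suc p)) (+-suc d p)))
         (inj₁ (there (there (∈-blueCycle-path (d + r) inside))))
    where
    inside : d + p < d + r
    inside = subst (λ x → suc x ≤ d + r) (cong (λ x → suc (suc (x + p))) (+-suc a w)) 1+j<n

  closing : ColouredEdge board blue (tour (d + r ∸ 1)) (tour 0)
  closing = colouredEdge-resp-≡ (trans (cong tour (sym lastPosition)) (tour-last r)) (tour-first z≤n)
                 (inj₁ (there (there (∈-blueCycle-closing (d + r)))))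
    where
    lastPosition : suc a + suc w + r ≡ d + r ∸ 1
    lastPosition = cong (λ x → suc x + r) (+-suc a w)

redLadder : ℕ → ℕ → Board
redLadder c zero    = []
redLadder c (suc i) = (c + 2 * i , 2 + (c + 2 * i) , red) ∷ redLadder c i

∈-redLadder : ∀ c {j t} → t < j → (c + 2 * t , 2 + (c + 2 * t) , red) ∈ redLadder c j
∈-redLadder c {suc j} {t} t<1+j with ≤-<-connex (suc t) j
... | inj₁ t<j = there (∈-redLadder c t<j)
... | inj₂ j<1+t with ≤∧≮⇒≡ (≤-pred t<1+j) (<⇒≱ j<1+t)
...   | refl = here refl

redLadder-avoids : ∀ c j {u v} → (∀ t → t < j → Avoids u v (c + 2 * t , 2 + (c + 2 * t) , red)) →
                   All (Avoids u v) (redLadder c j)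
redLadder-avoids c zero    _       = []
redLadder-avoids c (suc j) avoids = avoids j ≤-refl ∷ redLadder-avoids c j (λ t t<j → avoids t (m<n⇒m<1+n t<j))

2*-mono-< : ∀ c {t j} → t < j → c + 2 * t < c + 2 * j
2*-mono-< c t<j = +-monoʳ-< c (*-monoʳ-< 2 t<j)

redLadder-avoids-next : ∀ c j → All (Avoids (c + 2 * j) (2 + (c + 2 * j))) (redLadder c j)
redLadder-avoids-next c j = redLadder-avoids c j λ t t<j →
  avoids-missingʳ {col = red} (<⇒≢ (m<n⇒m<1+n (m<n⇒m<1+n (2*-mono-< c t<j))))
                  (λ eq → <⇒≢ (2*-mono-< c t<j) (suc-injective (suc-injective eq)))

RedRungs : Board → ℕ → ℕ → Set
RedRungs s c len = ∀ t → t < len → ColouredEdge s red (c + 2 * t) (2 + (c + 2 * t))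

redLadder-rungs : ∀ c j s → RedRungs (redLadder c j ++ s) c j
redLadder-rungs c j s t t<j = inj₁ (∈-++⁺ˡ (∈-redLadder c t<j))

double-suc : ∀ c t → c + 2 * suc t ≡ 2 + (c + 2 * t)
double-suc = solve-∀

redCycle-twoLadders : ∀ {s} c c′ α β → c + 2 * α < c′ →
  RedRungs s c α → ColouredEdge s red (c + 2 * α) (c′ + 2 * β) → RedRungs s c′ β → ColouredEdge s red c′ c →
  HasCycle red (2 + (α + β)) s
redCycle-twoLadders {s} c c′ α β c+2α<c′ ascent bridge descent closing′ = tour , injective , path , closing
  where
  tour : ℕ → ℕ
  tour i with i ≤? α
  ... | yes _ = c + 2 * i
  ... | no  _ = c′ + 2 * (suc (α + β) ∸ i)

  tour-ascent : ∀ {i} → i ≤ α → tour i ≡ c + 2 * i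
  tour-ascent {i} i≤α with i ≤? α
  ... | yes _   = refl
  ... | no  i≰α = ⊥-elim (i≰α i≤α)

  tour-descent : ∀ t → tour (suc α + t) ≡ c′ + 2 * (β ∸ t)
  tour-descent t with suc α + t ≤? α
  ... | yes ≤α = ⊥-elim (m+n≮m (suc α) t (s≤s ≤α))
  ... | no  _  = cong (λ x → c′ + 2 * x) ([m+n]∸[m+o]≡n∸o α β t)

  data Half (i : ℕ) : Set where
    ascending  : i ≤ α → Half i
    descending : ∀ t → t ≤ β → i ≡ suc α + t → Half i

  half : ∀ i → i < 2 + (α + β) → Half i
  half i i<len with ≤-<-connex i α
  ... | inj₁ i≤α = ascending i≤α
  ... | inj₂ α<i = descending (i ∸ suc α) t≤β (sym (m+[n∸m]≡n α<i))
    where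
    t≤β : i ∸ suc α ≤ β
    t≤β = +-cancelˡ-≤ (suc α) _ _ (subst (_≤ suc (α + β)) (sym (m+[n∸m]≡n α<i)) (≤-pred i<len))

  low : ∀ {i} x → i ≤ α → c + 2 * i < c′ + x
  low x i≤α = <-≤-trans (≤-<-trans (+-monoʳ-≤ c (*-monoʳ-≤ 2 i≤α)) c+2α<c′) (m≤m+n c′ x)

  injective : ∀ i j → i < 2 + (α + β) → j < 2 + (α + β) → tour i ≡ tour j → i ≡ j
  injective i j i<len j<len eq with half i i<len | half j j<len
  ... | ascending i≤α | ascending j≤α =
    *-cancelˡ-≡ i j 2 (+-cancelˡ-≡ c _ _ (trans (sym (tour-ascent i≤α)) (trans eq (tour-ascent j≤α))))
  ... | ascending i≤α | descending t _ refl =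
    ⊥-elim (<⇒≢ (low _ i≤α) (trans (sym (tour-ascent i≤α)) (trans eq (tour-descent t))))
  ... | descending t _ refl | ascending j≤α =
    ⊥-elim (<⇒≢ (low _ j≤α) (trans (sym (tour-ascent j≤α)) (trans (sym eq) (tour-descent t))))
  ... | descending t t≤β refl | descending t′ t′≤β refl =
    cong (suc α +_) (∸-cancelˡ-≡ t≤β t′≤β
      (*-cancelˡ-≡ _ _ 2 (+-cancelˡ-≡ c′ _ _ (trans (sym (tour-descent t)) (trans eq (tour-descent t′))))))

  path : ∀ i → suc i < 2 + (α + β) → ColouredEdge s red (tour i) (tour (suc i))
  path i 1+i<len with half i (<-trans (n<1+n i) 1+i<len)
  ... | ascending i≤α with ≤-<-connex (suc i) α
  ...   | inj₁ i<α = colouredEdge-resp-≡ (tour-ascent i≤α) (trans (tour-ascent i<α) (double-suc c i)) (ascent i i<α)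
  ...   | inj₂ α<1+i with ≤∧≮⇒≡ i≤α (<⇒≱ α<1+i)
  ...     | refl = colouredEdge-resp-≡ (tour-ascent i≤α) (trans (cong tour (sym (+-identityʳ (suc α)))) (tour-descent 0)) bridge
  path i 1+i<len | descending t _ refl =
    colouredEdge-resp-≡ (trans (tour-descent t) (trans (cong (λ x → c′ + 2 * x) (+-∸-assoc 1 t<β)) (double-suc c′ (β ∸ suc t))))
         (trans (cong tour (sym (+-suc (suc α) t))) (tour-descent (suc t)))
         (colouredEdge-sym (descent (β ∸ suc t) (∸-monoʳ-< z<s t<β)))
    where
    t<β : t < β
    t<β = +-cancelˡ-≤ α _ _ (subst (_≤ α + β) (sym (+-suc α t)) (≤-pred (≤-pred 1+i<len)))

  closing : ColouredEdge s red (tour (suc (α + β))) (tour 0)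
  closing = colouredEdge-resp-≡ (trans (tour-descent β) (trans (cong (λ x → c′ + 2 * x) (n∸n≡0 β)) (+-identityʳ c′)))
                 (trans (tour-ascent z≤n) (+-identityʳ c)) closing′

forceRedLadder : ∀ {k n m} c r s → blueCycle n ⊆ s → c + 2 * r ≤ n →
  (∀ j → j < r → All (Avoids (c + 2 * j) (2 + (c + 2 * j))) s) →
  BuilderWins k n m (redLadder c r ++ s) → BuilderWins k n (r + m) s
forceRedLadder {k} {n} {m} c r s blueCycle⊆s c+2r≤n avoids wins = play 0 r refl
  where
  play : ∀ i r′ → i + r′ ≡ r → BuilderWins k n (r′ + m) (redLadder c i ++ s)
  play i zero    i+0≡r = subst (λ j → BuilderWins k n m (redLadder c j ++ s)) (trans (sym i+0≡r) (+-identityʳ i)) wins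
  play i (suc r′) i+1+r′≡r =
    move u (2 + u) (<⇒≢ (m<n+m u {2} z<s)) (unselected (++⁺ (redLadder-avoids-next c i) (avoids i i<r)))
      λ { red  → play (suc i) r′ (trans (sym (+-suc i r′)) i+1+r′≡r)
        ; blue → ended (inj₂ (hasCycle-mono (∷⁺ʳ _ (λ e → ∈-++⁺ʳ (redLadder c i) (blueCycle⊆s e)))
                                            (blueCycle-shortcut u fits))) }
    where
    u : ℕ
    u = c + 2 * i
    i<r : i < r
    i<r = subst (i <_) i+1+r′≡r (m<m+n i z<s)
    fits : 2 + u ≤ n
    fits = ≤-trans (≤-reflexive (sym (double-suc c i))) (≤-trans (+-monoʳ-≤ c (*-monoʳ-≤ 2 i<r)) c+2r≤n)

blueChord-wins : ∀ {n} k′ a b c X → 2 ≤ k′ → 0 < c → a < c → c ≤ b → b < c + 2 * k′ → c + 2 * k′ ≤ n →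
  2 + a < b → c + (c + 2 * k′) ≡ 3 + (a + b) →
  (∀ u v → 0 < u → u < v → All (Avoids u v) X) →
  BuilderWins (suc k′) n (suc k′) ((a , b , blue) ∷ X ++ blueCycle n)
blueChord-wins {n} (suc (suc κ)) a b c X (s≤s (s≤s z≤n)) 0<c a<c c≤b b<d d≤n 2+a<b c+d≡3+a+b X-avoids =
  subst (λ m → BuilderWins (3 + κ) n m s) (+-comm (2 + κ) 1)
    (forceRedLadder c (2 + κ) s (xs⊆ys++xs _ ((a , b , blue) ∷ X)) d≤n rung-avoids closeLadder)
  where
  s : Board
  s = (a , b , blue) ∷ X ++ blueCycle n
  d : ℕ
  d = c + 2 * (2 + κ)
  a<b : a < b
  a<b = <-trans (m<n+m a {2} z<s) 2+a<b
  rung-avoids : ∀ j → j < 2 + κ → All (Avoids (c + 2 * j) (2 + (c + 2 * j))) s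
  rung-avoids j _ = avoids-chord {col = blue} a<b (λ eq → <⇒≢ 2+a<b (sym eq))
                  ∷ ++⁺ (X-avoids _ _ 0<u (m<n+m _ {2} z<s)) (blueCycle-avoids n ≤-refl (inj₁ 0<u))
    where
    0<u : 0 < c + 2 * j
    0<u = <-≤-trans 0<c (m≤m+n c _)
  c+2<d : 2 + c < d
  c+2<d = subst (_< d) (trans (double-suc c 0) (cong (2 +_) (+-identityʳ c))) (2*-mono-< c {1} (s≤s (s≤s z≤n)))
  c<d : c < d
  c<d = <-trans (m<n+m c {2} z<s) c+2<d
  closeLadder : BuilderWins (3 + κ) n 1 (redLadder c (2 + κ) ++ s)
  closeLadder = move c d (<⇒≢ c<d) (unselected fresh) λ
    { red  → ended (inj₁ redCycle)
    ; blue → ended (inj₂ (hasCycle-mono extend (blueCycle-twoChords a<c c≤b b<d d≤n c+d≡3+a+b))) }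
    where
    closed : Board
    closed = (c , d , red) ∷ redLadder c (2 + κ) ++ s
    rungs : RedRungs closed c (2 + κ)
    rungs t t<2+κ = colouredEdge-mono there (redLadder-rungs c (2 + κ) s t t<2+κ)
    redCycle : HasCycle red (3 + κ) closed
    redCycle = subst (λ len → HasCycle red len closed) (cong (2 +_) (+-identityʳ (suc κ)))
      (redCycle-twoLadders c d (suc κ) 0 (2*-mono-< c (n<1+n (suc κ)))
        (λ t t<1+κ → rungs t (m<n⇒m<1+n t<1+κ))
        (colouredEdge-resp-≡ refl (trans (+-identityʳ d) (double-suc c (suc κ))) (rungs (suc κ) ≤-refl))
        (λ _ ())
        (inj₂ (here refl)))
    fresh : All (Avoids c d) (redLadder c (2 + κ) ++ s)
    fresh = ++⁺ (redLadder-avoids c (2 + κ) (λ _ _ → chord-avoids {col = red} c<d (λ eq → <⇒≢ c+2<d (sym eq))))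
                (avoids-outside {col = blue} (<⇒≢ a<c) (<⇒≢ (<-trans a<c (≤-<-trans c≤b b<d)))
                 ∷ ++⁺ (X-avoids c d 0<c c<d)
                       (blueCycle-avoids n (<-trans (n<1+n (suc c)) c+2<d) (inj₁ 0<c)))
    extend : (c , d , blue) ∷ (a , b , blue) ∷ blueCycle n ⊆ (c , d , blue) ∷ redLadder c (2 + κ) ++ s
    extend (here e)          = here e
    extend (there (here e))  = there (∈-++⁺ʳ (redLadder c (2 + κ)) (here e))
    extend (there (there e)) = there (∈-++⁺ʳ (redLadder c (2 + κ)) (there (∈-++⁺ʳ X e)))

module BalancedStrategy (α β n : ℕ) (0<α : 0 < α) (β≤α : β ≤ α) (α≤1+β : α ≤ suc β)
                        (3S+3<n : 3 * (α + β) + 3 < n) where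

  S K q : ℕ
  S = α + β
  K = 3 + 2 * S
  q = K + 2 * β

  double : ∀ x → 2 * x ≡ x + x
  double = solve-∀

  2α≤1+S : 2 * α ≤ suc S
  2α≤1+S = subst₂ _≤_ (sym (double α)) (+-suc α β) (+-monoʳ-≤ α α≤1+β)

  2β≤S : 2 * β ≤ S
  2β≤S = subst (_≤ S) (sym (double β)) (+-monoˡ-≤ β β≤α)

  q≤3S+3 : q ≤ 3 * S + 3
  q≤3S+3 = ≤-trans (+-monoʳ-≤ K 2β≤S) (≤-reflexive (eq S))
    where eq : ∀ S → 3 + 2 * S + S ≡ 3 * S + 3
          eq = solve-∀

  q<n : q < n
  q<n = ≤-<-trans q≤3S+3 3S+3<n

  K<n : K < n
  K<n = ≤-<-trans (m≤m+n K (2 * β)) q<n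

  2α<K : 2 * α < K
  2α<K = ≤-<-trans 2α≤1+S (s≤s (s≤s (m≤n⇒m≤1+n (m≤m+n S _))))

  2+2α<q : 2 + 2 * α < q
  2+2α<q = ≤-trans (+-monoʳ-≤ 3 (*-monoʳ-≤ 2 (m≤m+n α β))) (m≤m+n K _)

  2α<q : 2 * α < q
  2α<q = <-trans (m<n+m _ {2} z<s) 2+2α<q

  0<2α : 0 < 2 * α
  0<2α = ≤-trans 0<α (m≤m+n α _)

  2≤1+S : 2 ≤ suc S
  2≤1+S = s≤s (≤-trans 0<α (m≤m+n α β))

  afterBlue : BuilderWins (2 + S) n (2 + S) ((0 , K , blue) ∷ blueCycle n)
  afterBlue = blueChord-wins (suc S) 0 K 2 [] 2≤1+S z<s z<s (s≤s (s≤s z≤n))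
    (≤-reflexive (d≡1+K S)) (subst (_≤ n) (d≡1+K S) K<n) (s≤s (s≤s (s≤s z≤n))) (sum S) (λ _ _ _ _ → [])
    where
    d≡1+K : ∀ S → suc (3 + 2 * S) ≡ 2 + 2 * suc S
    d≡1+K = solve-∀
    sum : ∀ S → 2 + (2 + 2 * suc S) ≡ 3 + (0 + (3 + 2 * S))
    sum = solve-∀

  R R₂ : Board
  R  = (0 , K , red) ∷ blueCycle n
  R₂ = (2 * α , q , red) ∷ R

  afterRedBlue : BuilderWins (2 + S) n (2 + S) ((2 * α , q , blue) ∷ R)
  afterRedBlue = blueChord-wins (suc S) (2 * α) q (2 + S) ((0 , K , red) ∷ []) 2≤1+S z<s (s≤s 2α≤1+S) (≤-trans (s≤s (s≤s (m≤n⇒m≤1+n (m≤m+n S _)))) (m≤m+n K _))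
    (subst (q <_) (d≡3S+4 S) (s≤s q≤3S+3)) (subst (_≤ n) (d≡3S+4 S) 3S+3<n) 2+2α<q (sum α β)
    (λ u v 0<u u<v → avoids-outside {col = red} (<⇒≢ 0<u) (<⇒≢ (<-trans 0<u u<v)) ∷ [])
    where
    d≡3S+4 : ∀ S → suc (3 * S + 3) ≡ 2 + S + 2 * suc S
    d≡3S+4 = solve-∀
    sum : ∀ α β → 2 + (α + β) + (2 + (α + β) + 2 * suc (α + β)) ≡ 3 + (2 * α + (3 + 2 * (α + β) + 2 * β))
    sum = solve-∀

  R₂-avoids : ∀ {u} → 0 < u ⊎ 2 + u < n → All (Avoids u (2 + u)) R₂
  R₂-avoids position = avoids-chord {col = red} 2α<q (λ eq → <⇒≢ 2+2α<q (sym eq))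
                     ∷ avoids-chord {col = red} z<s (λ ())
                     ∷ blueCycle-avoids n ≤-refl position

  ascent-avoids : ∀ j → j < α → All (Avoids (2 * j) (2 + 2 * j)) R₂
  ascent-avoids j j<α = R₂-avoids (inj₂ (≤-<-trans (subst (_≤ 2 * α) (double-suc 0 j) (*-monoʳ-≤ 2 j<α))
                                                    (<-trans 2α<K K<n)))

  descent-avoids : ∀ j → j < β → All (Avoids (K + 2 * j) (2 + (K + 2 * j))) (redLadder 0 α ++ R₂)
  descent-avoids j _ = ++⁺ (redLadder-avoids 0 α λ t t<α →
                              avoids-missingˡ {col = red} (<⇒≢ (<-trans (m<n+m _ {2} z<s) (below t<α))) (<⇒≢ (below t<α)))
                           (R₂-avoids (inj₁ (≤-trans (s≤s z≤n) (m≤m+n K _))))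
    where
    below : ∀ {t} → t < α → 2 + 2 * t < K + 2 * j
    below t<α = <-≤-trans (≤-<-trans (subst (_≤ 2 * α) (double-suc 0 _) (*-monoʳ-≤ 2 t<α)) 2α<K) (m≤m+n K _)

  redCycle : HasCycle red (2 + S) (redLadder K β ++ redLadder 0 α ++ R₂)
  redCycle = redCycle-twoLadders 0 K α β 2α<K
    (λ t t<α → colouredEdge-mono (xs⊆ys++xs _ (redLadder K β)) (redLadder-rungs 0 α R₂ t t<α))
    (inj₁ (∈-++⁺ʳ (redLadder K β) (∈-++⁺ʳ (redLadder 0 α) (here refl))))
    (redLadder-rungs K β _)
    (inj₂ (∈-++⁺ʳ (redLadder K β) (∈-++⁺ʳ (redLadder 0 α) (there (here refl)))))

  afterRedRed : BuilderWins (2 + S) n (2 + S) R₂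
  afterRedRed = builderWins-mono (≤-trans (≤-reflexive (cong (α +_) (+-identityʳ β))) (m≤n+m S 2))
    (forceRedLadder 0 α R₂ (λ e → there (there e)) (<⇒≤ (<-trans 2α<K K<n)) ascent-avoids
      (forceRedLadder K β (redLadder 0 α ++ R₂) (λ e → ∈-++⁺ʳ (redLadder 0 α) (there (there e)))
        (<⇒≤ q<n) descent-avoids (ended (inj₁ redCycle))))

  afterRed : BuilderWins (2 + S) n (3 + S) R
  afterRed = move (2 * α) q (<⇒≢ 2α<q)
    (unselected (avoids-outside {col = red} (<⇒≢ 0<2α) (λ ())
                 ∷ blueCycle-avoids n (<-trans (n<1+n _) 2+2α<q) (inj₁ 0<2α)))
    λ { red → afterRedRed ; blue → afterRedBlue }

  wins : BuilderWins (2 + S) n (4 + S) (blueCycle n)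
  wins = move 0 K (λ ()) (unselected (blueCycle-avoids n (s≤s (s≤s z≤n)) (inj₂ K<n)))
    λ { red → afterRed ; blue → builderWins-mono (n≤1+n _) afterBlue }

⌈n/2⌉≤1+⌊n/2⌋ : ∀ n → ⌈ n /2⌉ ≤ suc ⌊ n /2⌋
⌈n/2⌉≤1+⌊n/2⌋ zero          = z≤n
⌈n/2⌉≤1+⌊n/2⌋ (suc zero)    = ≤-refl
⌈n/2⌉≤1+⌊n/2⌋ (suc (suc n)) = s≤s (⌈n/2⌉≤1+⌊n/2⌋ n)

lemma3 : (k n : ℕ) → 3 ≤ k → 3 * k ∸ 3 < n →
    BuilderWins k n (k + 2) (blueCycle n)
lemma3 (suc (suc (suc S′))) n (s≤s (s≤s (s≤s z≤n))) 3k∸3<n =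
  subst (λ m → BuilderWins (3 + S′) n m (blueCycle n)) (+-comm 2 (3 + S′))
    (subst (λ S → BuilderWins (2 + S) n (4 + S) (blueCycle n)) α+β≡S
      (BalancedStrategy.wins α β n z<s (⌊n/2⌋≤⌈n/2⌉ (suc S′)) (⌈n/2⌉≤1+⌊n/2⌋ (suc S′))
        (subst (_< n) (trans (threes S′) (cong (λ S → 3 * S + 3) (sym α+β≡S))) 3k∸3<n)))
  where
  α β : ℕ
  α = ⌈ suc S′ /2⌉
  β = ⌊ suc S′ /2⌋
  α+β≡S : α + β ≡ suc S′
  α+β≡S = trans (+-comm α β) (⌊n/2⌋+⌈n/2⌉≡n (suc S′))
  -- The left-hand side is the normal form of 3 * (3 + S′) ∸ 3.
  threes : ∀ S′ → S′ + ((3 + S′) + ((3 + S′) + 0)) ≡ 3 * suc S′ + 3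
  threes = solve-∀
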